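{- Fix $k,p$ with $1\le k\le n-p\le n$. Let $w\in S_n$ be written as a concatenation $w=w_1w_2w_3$ where $w_1$ and $w_3$ are sequences of lengths $k$ and $p$. Then $$\sum_{T:\,(w,T)\in\mathcal{A}(\Gamma(k,p))}t^{\frac12(\ell(w)+\ell(wT)-|T|)}(1-t)^{|T|}=t^{\ell(w_1)+\ell(w_2w_3)+N_{w(1)}(w_3)}.$$ In particular, if $p=0$ (so $w=w_1w_2$), the sum equals $t^{\ell(w_1)+\ell(w_2)}$.
   Context: Permutations in one-line notation; $(a,b)$, $a<b$, a transposition; $wT:=wt_1\cdots t_s$ for $T=(t_1,\dots,t_s)$ (right multiplication by $(a,b)$ swaps entries in positions $a,b$); Bruhat order as usual. For any finite sequence $u$ of distinct integers, $\ell(u)$ is its number of inversions (pairs $i<j$ with $u(i)>u(j)$), and $N_a(u)$ is the number of entries of $u$ smaller than $a$. $\Gamma(k)$ is the sequence $((1,n),(1,n-1),\dots,(1,k+1),(2,n),\dots,(2,k+1),\dots,(k,n),\dots,(k,k+1))$ (empty if $k=n$), and $\Gamma(k,p)$ is obtained from $\Gamma(k)$ by removing its first $p$ entries. $\mathcal{A}(\Gamma(k,p))$ is the set of pairs $(w,T)$ with $w\in S_n$ and $T=(t_1,\dots,t_s)$ a subsequence (choice of positions) of $\Gamma(k,p)$ with $w>wt_1>wt_1t_2>\dots>wt_1\cdots t_s$ strictly in Bruhat order. $|T|$ is the length of $T$. -}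

module Defs where

open import Level using (Level)
open import Data.Nat using (ℕ; zero; suc; _+_; _∸_; _<_; _≤_; _<ᵇ_; _≡ᵇ_)
open import Data.Nat.DivMod using (_/_)
open import Data.Bool using (Bool; true; false; if_then_else_)
open import Data.List using (List; []; _∷_; length; filter; map; upTo; applyUpTo; concatMap; drop; foldl; sum)
open import Data.Product using (_×_; _,_; Σ; ∃)
open import Data.Unit using (⊤)
open import Relation.Nullary using (¬_)
open import Relation.Binary.PropositionalEquality using (_≡_)
open import Relation.Binary.Construct.Closure.ReflexiveTransitive using (Star)
open import Algebra.Bundles using (CommutativeRing)

-- 1-based entry u(i) of a sequence (0 if out of range)
entry : List ℕ → ℕ → ℕ
entry []       _             = 0
entry (x ∷ xs) zero          = 0
entry (x ∷ xs) (suc zero)    = x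
entry (x ∷ xs) (suc (suc i)) = entry xs (suc i)

-- the permutation [1,2,...,n] in one-line notation
idPerm : ℕ → List ℕ
idPerm n = applyUpTo suc n

inv : List ℕ → ℕ
inv []       = 0
inv (x ∷ xs) = length (filter (λ y → Data.Nat._<?_ y x) xs) + inv xs

N : ℕ → List ℕ → ℕ
N a u = length (filter (λ y → Data.Nat._<?_ y a) u)

-- u (a,b): swap the entries in (1-based) positions a and b
swapPos : List ℕ → ℕ × ℕ → List ℕ
swapPos u (a , b) = applyUpTo f (length u)
  where
  g : ℕ → ℕ
  g i = if i ≡ᵇ a then entry u b else (if i ≡ᵇ b then entry u a else entry u i)
  f : ℕ → ℕ
  f i = g (suc i)

rmul : List ℕ → List (ℕ × ℕ) → List ℕ
rmul = foldl swapPos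

-- Bruhat order (Björner–Brenti Def. 2.1.1): u → v iff v = u t for a
-- transposition t = (a,b), 1 ≤ a < b ≤ n, and ℓ(u) < ℓ(v);
-- u ≤ v iff there is a chain u → ... → v.
BruhatStep : List ℕ → List ℕ → Set
BruhatStep u v = Σ ℕ λ a → Σ ℕ λ b →
  (1 ≤ a) × (a < b) × (b ≤ length u) × (v ≡ swapPos u (a , b)) × (inv u < inv v)

BruhatLe : List ℕ → List ℕ → Set
BruhatLe = Star BruhatStep

BruhatLt : List ℕ → List ℕ → Set
BruhatLt u v = BruhatLe u v × ¬ (u ≡ v)

Chain : List ℕ → List (ℕ × ℕ) → Set
Chain w []       = ⊤
Chain w (t ∷ ts) = BruhatLt (swapPos w t) w × Chain (swapPos w t) ts

Γ : ℕ → ℕ → List (ℕ × ℕ)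
Γ n k = concatMap (λ a → map (λ j → (a , n ∸ j)) (upTo (n ∸ k))) (applyUpTo suc k)

Γp : ℕ → ℕ → ℕ → List (ℕ × ℕ)
Γp n k p = drop p (Γ n k)

select : {A : Set} → List Bool → List A → List A
select []          _        = []
select (_ ∷ _)     []       = []
select (true ∷ m)  (x ∷ xs) = x ∷ select m xs
select (false ∷ m) (x ∷ xs) = select m xs

-- (w, T) ∈ A(Γ(k,p)), T given as a mask of positions in Γ(k,p)
InA : ℕ → ℕ → ℕ → List ℕ → List Bool → Set
InA n k p w m = (length m ≡ length (Γp n k p)) × Chain w (select m (Γp n k p))

module _ {c ℓ : Level} (R : CommutativeRing c ℓ) where
  open CommutativeRing R renaming (_+_ to _+R_; _*_ to _*R_; _-_ to _-R_)

  pow : Carrier → ℕ → Carrier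
  pow x zero    = 1#
  pow x (suc e) = x *R pow x e

  ringSum : List Carrier → Carrier
  ringSum []       = 0#
  ringSum (x ∷ xs) = x +R ringSum xs

  summand : Carrier → List ℕ → List (ℕ × ℕ) → Carrier
  summand t w T = pow t (((inv w + inv (rmul w T)) ∸ length T) / 2) *R pow (1# -R t) (length T)

module Submission where

-- Write w = x v w₂ w₃ with |x v| = k and |w₃| = p.  Then Γ(k,p) is a column
-- (1,k+|w₂|), …, (1,k+1), whose members exchange x with an entry of w₂, followed
-- by Γ(k-1) acting on positions 2..n.  First, (w,g) is a Bruhat cover w g < w
-- exactly when g is a descent, so the admissible masks are enumerated by an
-- explicit recursion (chainMasks) and the sum becomes a recursive sum (chainSum):
--   * an ascent g contributes nothing, a descent splits the sum as
--     S(w,G) + t^d (1-t) S(w g, G), where ℓ(w) - ℓ(w g) = 2d+1;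
--   * transpositions avoiding position 1 factor out t^{N_{w(1)}(rest)}.
-- The theorem follows by induction on k and, inside, on |w₂|: one column step
-- uses t^{A+1} + t^d (1-t) t^{A-d} = t^A together with an inversion-count
-- identity (exponent-exchange).

open import Defs
open import Level using (Level)
open import Function.Base using (_∘_)
open import Function.Bundles using (_⇔_; Equivalence)
open import Data.Empty using (⊥-elim)
open import Data.Unit using (tt)
open import Data.Bool using (Bool; true; false; if_then_else_)
open import Data.Product using (Σ; _×_; _,_; proj₁; proj₂)
open import Data.Sum using (inj₁; inj₂)
open import Data.Nat using (ℕ; zero; suc; _+_; _∸_; _≤_; _<_; _≡ᵇ_; z≤n; s≤s; _<?_)
import Data.Nat.Properties as ℕₚ
open ℕₚ using (<-asym; <-cmp; <-irrefl; <-trans; <-≤-trans; <⇒≤; ≤-antisym; ≤-refl; ≤-reflexive; ≤-trans; ≮⇒≥;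
  +-suc; +-monoʳ-≤; +-∸-assoc; m+[n∸m]≡n; m+n∸m≡n; m+n∸n≡m; m<m+n; m∸n≤m; m≤m+n; n≤1+n; suc-injective)
open import Data.Nat.DivMod using (_/_; m/n≡1+[m∸n]/n)
open import Data.Nat.Tactic.RingSolver using (solve-∀)
open import Data.List using (List; []; _∷_; _++_; [_]; length; map; concat; drop; applyUpTo; upTo; filter)
open import Data.List.Properties
  using (filter-accept; filter-reject; filter-++; length-++; length-map; length-applyUpTo;
         map-++; map-∘; map-applyUpTo; ++-assoc; ++-identityʳ; ∷-injectiveʳ)
open import Data.List.Membership.Propositional using (_∈_; _∉_)
open import Data.List.Membership.Propositional.Properties using (∈-map⁺; ∈-map⁻; ∈-++⁺ˡ; ∈-++⁺ʳ; ∈-++⁻)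
open import Data.List.Membership.Propositional.Properties.WithK using (unique∧set⇒bag)
open import Data.List.Relation.Unary.Any using (here; there)
open import Data.List.Relation.Unary.All as All using (All; []; _∷_)
import Data.List.Relation.Unary.All.Properties as All
open import Data.List.Relation.Unary.AllPairs using (_∷_)
open import Data.List.Relation.Unary.Unique.Propositional using (Unique; [])
import Data.List.Relation.Unary.Unique.Propositional.Properties as Unique
open import Data.List.Relation.Binary.Permutation.Propositional as ↭ using (_↭_; ↭-sym; ↭-trans; ↭⇒↭ₛ)
import Data.List.Relation.Binary.Permutation.Propositional.Properties as ↭
import Data.List.Relation.Binary.Permutation.Setoid.Properties as ↭ₛ
open import Data.List.Relation.Binary.BagAndSetEquality using (∼bag⇒↭)
open import Relation.Nullary using (¬_; Dec; yes; no)
open import Relation.Binary.Definitions using (tri<; tri≈; tri>)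
open import Relation.Binary.PropositionalEquality
  using (_≡_; _≢_; refl; sym; trans; cong; cong₂; subst; subst₂; setoid; module ≡-Reasoning)
open import Relation.Binary.Construct.Closure.ReflexiveTransitive using (ε; _◅_)
open import Algebra.Bundles using (CommutativeRing)

N-cons-< : ∀ {a y} ys → y < a → N a (y ∷ ys) ≡ suc (N a ys)
N-cons-< {a} ys y<a = cong length (filter-accept (_<? a) y<a)

N-cons-≮ : ∀ {a y} ys → ¬ y < a → N a (y ∷ ys) ≡ N a ys
N-cons-≮ {a} ys y≮a = cong length (filter-reject (_<? a) y≮a)

N-++ : ∀ a xs ys → N a (xs ++ ys) ≡ N a xs + N a ys
N-++ a xs ys = trans (cong length (filter-++ (_<? a) xs ys)) (length-++ (filter (_<? a) xs))

N-↭ : ∀ a {xs ys} → xs ↭ ys → N a xs ≡ N a ys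
N-↭ a p = ↭.↭-length (↭.filter-↭ (_<? a) p)

above : ℕ → List ℕ → ℕ
above z []      = 0
above z (m ∷ L) with z <? m
... | yes _ = suc (above z L)
... | no _  = above z L

between : ℕ → ℕ → List ℕ → ℕ
between y x []      = 0
between y x (m ∷ L) with y <? m | m <? x
... | yes _ | yes _ = suc (between y x L)
... | yes _ | no _  = between y x L
... | no _  | _     = between y x L

between-++ : ∀ y x (A B : List ℕ) → between y x (A ++ B) ≡ between y x A + between y x B
between-++ y x []      B = refl
between-++ y x (m ∷ A) B with y <? m | m <? x
... | yes _ | yes _ = cong suc (between-++ y x A B)
... | yes _ | no _  = between-++ y x A B
... | no _  | _     = between-++ y x A B

crossInv : List ℕ → List ℕ → ℕ
crossInv []       ys = 0
crossInv (x ∷ xs) ys = N x ys + crossInv xs ys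

N-between : ∀ {y x} L → y < x → y ∉ L → N x L ≡ N y L + between y x L
N-between [] y<x y∉ = refl
N-between {y} {x} (m ∷ L) y<x y∉ with y <? m | m <? x
... | yes y<m | yes m<x
  rewrite N-cons-< {x} L m<x | N-cons-≮ {y} L (<-asym y<m) | N-between L y<x (y∉ ∘ there)
  = sym (+-suc _ _)
... | yes y<m | no m≮x
  rewrite N-cons-≮ {x} L m≮x | N-cons-≮ {y} L (<-asym y<m) = N-between L y<x (y∉ ∘ there)
... | no y≮m | _ with m <? y
...   | yes m<y rewrite N-cons-< {x} L (<-trans m<y y<x) | N-cons-< {y} L m<y
  = cong suc (N-between L y<x (y∉ ∘ there))
...   | no m≮y = ⊥-elim (y∉ (here (≤-antisym (≮⇒≥ m≮y) (≮⇒≥ y≮m))))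

above-between : ∀ {y x} L → y < x → x ∉ L → above y L ≡ above x L + between y x L
above-between [] y<x x∉ = refl
above-between {y} {x} (m ∷ L) y<x x∉ with y <? m | m <? x | x <? m
... | yes y<m | yes m<x | yes x<m = ⊥-elim (<-asym m<x x<m)
... | yes y<m | yes m<x | no _    = trans (cong suc (above-between L y<x (x∉ ∘ there))) (sym (+-suc _ _))
... | yes y<m | no m≮x  | yes x<m = cong suc (above-between L y<x (x∉ ∘ there))
... | yes y<m | no m≮x  | no x≮m  = ⊥-elim (x∉ (here (≤-antisym (≮⇒≥ m≮x) (≮⇒≥ x≮m))))
... | no y≮m  | _       | yes x<m = ⊥-elim (y≮m (<-trans y<x x<m))
... | no y≮m  | _       | no _    = above-between L y<x (x∉ ∘ there)

crossInv-cons : ∀ M y S → crossInv M (y ∷ S) ≡ above y M + crossInv M S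
crossInv-cons []      y S = refl
crossInv-cons (m ∷ M) y S with y <? m
... | yes y<m rewrite N-cons-< {m} S y<m | crossInv-cons M y S = arith (N m S) (above y M) (crossInv M S)
  where arith : ∀ a b c → suc a + (b + c) ≡ suc (b + (a + c))
        arith = solve-∀
... | no y≮m rewrite N-cons-≮ {m} S y≮m | crossInv-cons M y S = arith (N m S) (above y M) (crossInv M S)
  where arith : ∀ a b c → a + (b + c) ≡ b + (a + c)
        arith = solve-∀

crossInv-↭ : ∀ M {ys zs} → ys ↭ zs → crossInv M ys ≡ crossInv M zs
crossInv-↭ []      p = refl
crossInv-↭ (m ∷ M) p = cong₂ _+_ (N-↭ m p) (crossInv-↭ M p)

inv-++ : ∀ xs ys → inv (xs ++ ys) ≡ inv xs + crossInv xs ys + inv ys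
inv-++ []       ys = refl
inv-++ (x ∷ xs) ys rewrite N-++ x xs ys | inv-++ xs ys =
  arith (N x xs) (N x ys) (inv xs) (crossInv xs ys) (inv ys)
  where arith : ∀ a b c d e → a + b + (c + d + e) ≡ a + c + (b + d) + e
        arith = solve-∀

inv-exchange-front : ∀ {x y} M S → y < x → x ∉ M → y ∉ M →
  inv (x ∷ M ++ y ∷ S) ≡ inv (y ∷ M ++ x ∷ S) + suc (between y x M + between y x M)
inv-exchange-front {x} {y} M S y<x x∉ y∉
  rewrite N-++ x M (y ∷ S) | N-++ y M (x ∷ S) | N-cons-< {x} S y<x | N-cons-≮ {y} S (<-asym y<x)
        | inv-++ M (y ∷ S) | inv-++ M (x ∷ S) | crossInv-cons M y S | crossInv-cons M x S
        | N-between M y<x y∉ | above-between M y<x x∉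
  = arith (N y M) (between y x M) (N x S) (N y S) (inv M) (above x M) (crossInv M S) (inv S)
  where arith : ∀ a d b c e f g h →
                a + d + suc b + (e + (f + d + g) + (c + h)) ≡ a + c + (e + (f + g) + (b + h)) + suc (d + d)
        arith = solve-∀

exchange-↭ : ∀ (P : List ℕ) x M y S → P ++ x ∷ M ++ y ∷ S ↭ P ++ y ∷ M ++ x ∷ S
exchange-↭ P x M y S = ↭.++⁺ˡ P
  (↭-trans (↭.prep x (↭.shift y M S)) (↭-trans (↭.swap x y ↭.refl) (↭.prep y (↭-sym (↭.shift x M S)))))

-- The same count with an arbitrary prefix P, which contributes equally to both sides.
inv-exchange : ∀ P {x y} (M S : List ℕ) → y < x → x ∉ M → y ∉ M →
  inv (P ++ x ∷ M ++ y ∷ S) ≡ inv (P ++ y ∷ M ++ x ∷ S) + suc (between y x M + between y x M)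
inv-exchange P {x} {y} M S y<x x∉ y∉ =
  trans (inv-++ P (x ∷ M ++ y ∷ S))
  (trans (cong₂ (λ a b → inv P + a + b) (crossInv-↭ P (exchange-↭ [] x M y S)) (inv-exchange-front M S y<x x∉ y∉))
  (trans (arith (inv P) (crossInv P (y ∷ M ++ x ∷ S)) (inv (y ∷ M ++ x ∷ S)) (between y x M))
  (cong (_+ suc (between y x M + between y x M)) (sym (inv-++ P (y ∷ M ++ x ∷ S))))))
  where arith : ∀ a b c d → a + b + (c + suc (d + d)) ≡ a + b + c + suc (d + d)
        arith = solve-∀

inv-exchange-< : ∀ P {x y} (M S : List ℕ) → y < x → x ∉ M → y ∉ M →
  inv (P ++ y ∷ M ++ x ∷ S) < inv (P ++ x ∷ M ++ y ∷ S)
inv-exchange-< P {x} {y} M S y<x x∉ y∉ =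
  subst (inv (P ++ y ∷ M ++ x ∷ S) <_) (sym (inv-exchange P M S y<x x∉ y∉)) (m<m+n _ (s≤s z≤n))

setAt : List ℕ → ℕ → ℕ → List ℕ
setAt []      _       _ = []
setAt (z ∷ u) zero    x = x ∷ u
setAt (z ∷ u) (suc j) x = z ∷ setAt u j x

applyUpTo-entry : ∀ u → applyUpTo (λ i → entry u (suc i)) (length u) ≡ u
applyUpTo-entry []      = refl
applyUpTo-entry (z ∷ u) = cong (z ∷_) (applyUpTo-entry u)

applyUpTo-setAt : ∀ u j x →
  applyUpTo (λ i → if i ≡ᵇ j then x else entry u (suc i)) (length u) ≡ setAt u j x
applyUpTo-setAt []      j       x = refl
applyUpTo-setAt (z ∷ u) zero    x = cong (x ∷_) (applyUpTo-entry u)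
applyUpTo-setAt (z ∷ u) (suc j) x = cong (z ∷_) (applyUpTo-setAt u j x)

entry-after : ∀ (M : List ℕ) y S → entry (M ++ y ∷ S) (suc (length M)) ≡ y
entry-after []           y S = refl
entry-after (m ∷ [])     y S = refl
entry-after (m ∷ m' ∷ M) y S = entry-after (m' ∷ M) y S

setAt-after : ∀ (M : List ℕ) y S x → setAt (M ++ y ∷ S) (length M) x ≡ M ++ x ∷ S
setAt-after []      y S x = refl
setAt-after (m ∷ M) y S x = cong (m ∷_) (setAt-after M y S x)

entry-second : ∀ P (x : ℕ) M y S → entry (P ++ x ∷ M ++ y ∷ S) (suc (length P + suc (length M))) ≡ y
entry-second []           x M y S = entry-after M y S
entry-second (z ∷ [])     x M y S = entry-after (x ∷ M) y S
entry-second (z ∷ z' ∷ P) x M y S = entry-second (z' ∷ P) x M y S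

swapPos-exchange : ∀ P x M y S →
  swapPos (P ++ x ∷ M ++ y ∷ S) (suc (length P) , suc (length P + suc (length M))) ≡ P ++ y ∷ M ++ x ∷ S
swapPos-exchange []      x M y S =
  cong₂ _∷_ (entry-after M y S) (trans (applyUpTo-setAt (M ++ y ∷ S) (length M) x) (setAt-after M y S x))
swapPos-exchange (z ∷ P) x M y S = cong (z ∷_) (swapPos-exchange P x M y S)

Valid : ℕ → ℕ × ℕ → Set
Valid n (a , b) = (1 ≤ a) × (a < b) × (b ≤ n)

AllValid : ℕ → List (ℕ × ℕ) → Set
AllValid n = All (Valid n)

record Cut (w : List ℕ) (a b : ℕ) : Set where
  constructor cut
  field
    P : List ℕ
    x : ℕ
    M : List ℕ
    y : ℕ
    S : List ℕ
    w≡ : w ≡ P ++ x ∷ M ++ y ∷ S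
    a≡ : a ≡ suc (length P)
    b≡ : b ≡ suc (length P + suc (length M))

cutAt : ∀ (R : List ℕ) j → j < length R →
  Σ (List ℕ) λ M → Σ ℕ λ y → Σ (List ℕ) λ S → (R ≡ M ++ y ∷ S) × (length M ≡ j)
cutAt (y ∷ R) zero    _       = [] , y , R , refl , refl
cutAt (z ∷ R) (suc j) (s≤s p) with cutAt R j p
... | M , y , S , R≡ , |M| = z ∷ M , y , S , cong (z ∷_) R≡ , cong suc |M|

cutValid : ∀ w a b → Valid (length w) (a , b) → Cut w a b
cutValid (x ∷ R) (suc zero) (suc (suc j)) (_ , _ , s≤s p) with cutAt R j p
... | M , y , S , R≡ , |M| = cut [] x M y S (cong (x ∷_) R≡) refl (cong (suc ∘ suc) (sym |M|))
cutValid (z ∷ w) (suc (suc a)) (suc (suc b)) (_ , s≤s a<b , s≤s p)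
  with cutValid w (suc a) (suc b) (s≤s z≤n , a<b , p)
... | cut P x M y S w≡ a≡ b≡ = cut (z ∷ P) x M y S (cong (z ∷_) w≡) (cong suc a≡) (cong suc b≡)
cutValid []      (suc zero)    (suc (suc j)) (_ , _ , ())
cutValid w       (suc zero)    (suc zero)    (_ , s≤s () , _)
cutValid w       (suc (suc a)) (suc zero)    (_ , s≤s () , _)

swapPos-length : ∀ w g → length (swapPos w g) ≡ length w
swapPos-length w g = length-applyUpTo _ (length w)

swapPos-↭ : ∀ w g → Valid (length w) g → swapPos w g ↭ w
swapPos-↭ w (a , b) v with cutValid w a b v
... | cut P x M y S refl refl refl rewrite swapPos-exchange P x M y S = ↭-sym (exchange-↭ P x M y S)

AllValid-swapPos : ∀ w g G → AllValid (length w) G → AllValid (length (swapPos w g)) G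
AllValid-swapPos w g G = subst (λ n → AllValid n G) (sym (swapPos-length w g))

unique-↭ : ∀ {xs ys : List ℕ} → xs ↭ ys → Unique xs → Unique ys
unique-↭ p = ↭ₛ.Unique-resp-↭ (setoid ℕ) (↭⇒↭ₛ p)

swapPos-unique : ∀ w g → Valid (length w) g → Unique w → Unique (swapPos w g)
swapPos-unique w g v = unique-↭ (↭-sym (swapPos-↭ w g v))

record Distinct (x : ℕ) (M : List ℕ) (y : ℕ) : Set where
  field
    x∉M : x ∉ M
    y∉M : y ∉ M
    x≢y : x ≢ y

distinct : ∀ P x M y S → Unique (P ++ x ∷ M ++ y ∷ S) → Distinct x M y
distinct []      x M y S (x∉ ∷ u) = record
  { x∉M = All.All¬⇒¬Any (All.++⁻ˡ M x∉)
  ; y∉M = y∉ M u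
  ; x≢y = All.head (All.++⁻ʳ M x∉) }
  where
  y∉ : ∀ M {S} → Unique (M ++ y ∷ S) → y ∉ M
  y∉ (m ∷ M) (m∉ ∷ _) (here y≡m) = All.head (All.++⁻ʳ M m∉) (sym y≡m)
  y∉ (m ∷ M) (_ ∷ u)  (there p)  = y∉ M u p
distinct (_ ∷ P) x M y S (_ ∷ u) = distinct P x M y S u

BruhatLe⇒inv≤ : ∀ {u v} → BruhatLe u v → inv u ≤ inv v
BruhatLe⇒inv≤ ε = ≤-refl
BruhatLe⇒inv≤ ((_ , _ , _ , _ , _ , refl , lt) ◅ r) = ≤-trans (<⇒≤ lt) (BruhatLe⇒inv≤ r)

BruhatLt⇒inv< : ∀ {u v} → BruhatLt u v → inv u < inv v
BruhatLt⇒inv< (ε , u≢v) = ⊥-elim (u≢v refl)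
BruhatLt⇒inv< ((_ , _ , _ , _ , _ , refl , lt) ◅ r , _) = <-≤-trans lt (BruhatLe⇒inv≤ r)

chain-length : ∀ w T → Chain w T → length T + inv (rmul w T) ≤ inv w
chain-length w []      _        = ≤-refl
chain-length w (t ∷ T) (lt , c) = <-≤-trans (s≤s (chain-length (swapPos w t) T c)) (BruhatLt⇒inv< lt)

Descent : List ℕ → ℕ × ℕ → Set
Descent w (a , b) = entry w b < entry w a

descent? : ∀ w g → Dec (Descent w g)
descent? w (a , b) = entry w b <? entry w a

descent⇒cover : ∀ w g → Valid (length w) g → Unique w → Descent w g → BruhatLt (swapPos w g) w
descent⇒cover w (a , b) v u d with cutValid w a b v
... | cut P x M y S refl refl refl
  rewrite swapPos-exchange P x M y S | entry-after P x (M ++ y ∷ S) | entry-second P x M y S =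
  ((suc (length P) , suc (length P + suc (length M)) , proj₁ v , proj₁ (proj₂ v) ,
    ≤-trans (proj₂ (proj₂ v)) (≤-reflexive (↭.↭-length (exchange-↭ P x M y S))) ,
    sym (swapPos-exchange P y M x S) , lower) ◅ ε)
  , λ e → <-irrefl (cong inv e) lower
  where
  open Distinct (distinct P x M y S u)
  lower : inv (P ++ y ∷ M ++ x ∷ S) < inv (P ++ x ∷ M ++ y ∷ S)
  lower = inv-exchange-< P M S d x∉M y∉M

cover⇒descent : ∀ w g → Valid (length w) g → Unique w → BruhatLt (swapPos w g) w → Descent w g
cover⇒descent w (a , b) v u lt with cutValid w a b v
... | cut P x M y S refl refl refl
  rewrite swapPos-exchange P x M y S | entry-after P x (M ++ y ∷ S) | entry-second P x M y S
  with <-cmp x y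
... | tri< x<y _ _ = ⊥-elim (<-asym (BruhatLt⇒inv< lt) (inv-exchange-< P M S x<y y∉M x∉M))
  where open Distinct (distinct P x M y S u)
... | tri≈ _ x≡y _ = ⊥-elim (Distinct.x≢y (distinct P x M y S u) x≡y)
... | tri> _ _ y<x = y<x

-- Chain masks.  The masks T ⊆ G with (w,T) ∈ A(G) are listed by a recursion on G,
-- which turns the sum over an arbitrary list of them into a recursive sum.

keepIf : {P : Set} {A : Set} → Dec P → List A → List A
keepIf (yes _) xs = xs
keepIf (no _)  _  = []

chainMasks : List ℕ → List (ℕ × ℕ) → List (List Bool)
chainMasks w []      = [] ∷ []
chainMasks w (g ∷ G) =
  map (false ∷_) (chainMasks w G) ++ keepIf (descent? w g) (map (true ∷_) (chainMasks (swapPos w g) G))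

-- chainMasks contains exactly the masks of full length describing a descending chain
-- (completeness uses that Bruhat covers are descents, soundness the converse) …
chainMasks-complete : ∀ w G → AllValid (length w) G → Unique w →
  ∀ m → length m ≡ length G → Chain w (select m G) → m ∈ chainMasks w G
chainMasks-complete w []      _        _ []          _  _ = here refl
chainMasks-complete w (g ∷ G) (v ∷ vs) u (false ∷ m) eq c =
  ∈-++⁺ˡ (∈-map⁺ (false ∷_) (chainMasks-complete w G vs u m (suc-injective eq) c))
chainMasks-complete w (g ∷ G) (v ∷ vs) u (true ∷ m)  eq (lt , c) with descent? w g
... | yes _ = ∈-++⁺ʳ (map (false ∷_) (chainMasks w G)) (∈-map⁺ (true ∷_)
                (chainMasks-complete (swapPos w g) G (AllValid-swapPos w g G vs) (swapPos-unique w g v u)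
                   m (suc-injective eq) c))
... | no ¬d = ⊥-elim (¬d (cover⇒descent w g v u lt))

chainMasks-sound : ∀ w G → AllValid (length w) G → Unique w →
  ∀ m → m ∈ chainMasks w G → (length m ≡ length G) × Chain w (select m G)
chainMasks-sound w []      _        _ m (here refl) = refl , tt
chainMasks-sound w (g ∷ G) (v ∷ vs) u m p with ∈-++⁻ (map (false ∷_) (chainMasks w G)) p
... | inj₁ q with ∈-map⁻ (false ∷_) q
...   | m' , q' , refl with chainMasks-sound w G vs u m' q'
...     | eq , c = cong suc eq , c
chainMasks-sound w (g ∷ G) (v ∷ vs) u m p | inj₂ q with descent? w g
... | yes d with ∈-map⁻ (true ∷_) q
...   | m' , q' , refl
  with chainMasks-sound (swapPos w g) G (AllValid-swapPos w g G vs) (swapPos-unique w g v u) m' q'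
...     | eq , c = cong suc eq , descent⇒cover w g v u d , c
chainMasks-sound w (g ∷ G) (v ∷ vs) u m p | inj₂ () | no _

-- … and each of them once, since the two branches start with different bits.
chainMasks-unique : ∀ w G → Unique (chainMasks w G)
chainMasks-unique w []      = [] ∷ []
chainMasks-unique w (g ∷ G) with descent? w g
... | yes _ = Unique.++⁺ (Unique.map⁺ ∷-injectiveʳ (chainMasks-unique w G))
                         (Unique.map⁺ ∷-injectiveʳ (chainMasks-unique (swapPos w g) G)) disjoint
  where
  disjoint : ∀ {m} → ¬ (m ∈ map (false ∷_) (chainMasks w G) × m ∈ map (true ∷_) (chainMasks (swapPos w g) G))
  disjoint (p , q) with ∈-map⁻ (false ∷_) p | ∈-map⁻ (true ∷_) q
  ... | _ , _ , refl | _ , _ , ()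
... | no _  = subst Unique (sym (++-identityʳ _)) (Unique.map⁺ ∷-injectiveʳ (chainMasks-unique w G))

chainMasks-↭ : ∀ w G → AllValid (length w) G → Unique w →
  (masks : List (List Bool)) → Unique masks →
  (∀ m → (m ∈ masks) ⇔ ((length m ≡ length G) × Chain w (select m G))) → masks ↭ chainMasks w G
chainMasks-↭ w G vs u masks um iff = ∼bag⇒↭ (unique∧set⇒bag um (chainMasks-unique w G) λ {m} → record
  { to        = λ p → let (eq , c) = Equivalence.to (iff m) p in chainMasks-complete w G vs u m eq c
  ; from      = λ p → Equivalence.from (iff m) (chainMasks-sound w G vs u m p)
  ; to-cong   = λ { refl → refl }
  ; from-cong = λ { refl → refl } })

raise : ℕ × ℕ → ℕ × ℕ
raise (a , b) = (suc a , suc b)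

raise-valid : ∀ {n} G → AllValid n G → AllValid (suc n) (map raise G)
raise-valid []      []                   = []
raise-valid (g ∷ G) ((1≤a , a<b , b≤n) ∷ vs) = (s≤s z≤n , s≤s a<b , s≤s b≤n) ∷ raise-valid G vs

select-raise : ∀ m G → select m (map raise G) ≡ map raise (select m G)
select-raise []          G       = refl
select-raise (b ∷ m)     []      = refl
select-raise (true ∷ m)  (g ∷ G) = cong (raise g ∷_) (select-raise m G)
select-raise (false ∷ m) (g ∷ G) = select-raise m G

select-valid : ∀ {n} m G → AllValid n G → AllValid n (select m G)
select-valid []          G       vs       = []
select-valid (b ∷ m)     []      vs       = []
select-valid (true ∷ m)  (g ∷ G) (v ∷ vs) = v ∷ select-valid m G vs
select-valid (false ∷ m) (g ∷ G) (v ∷ vs) = select-valid m G vs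

rmul-raise : ∀ x u T → AllValid (length u) T → rmul (x ∷ u) (map raise T) ≡ x ∷ rmul u T
rmul-raise x u []                       _ = refl
rmul-raise x u ((suc a , suc (suc b)) ∷ T) (v ∷ vs) =
  rmul-raise x (swapPos u (suc a , suc (suc b))) T (AllValid-swapPos u (suc a , suc (suc b)) T vs)
rmul-raise x u ((suc a , suc zero) ∷ T) ((_ , s≤s () , _) ∷ _)

rmul-↭ : ∀ u T → AllValid (length u) T → rmul u T ↭ u
rmul-↭ u []      _        = ↭.refl
rmul-↭ u (g ∷ T) (v ∷ vs) = ↭-trans (rmul-↭ (swapPos u g) T (AllValid-swapPos u g T vs)) (swapPos-↭ u g v)

-- Raised transpositions never move the first entry, so their chain masks are those of the tail.
chainMasks-raise : ∀ x u G → AllValid (length u) G → chainMasks (x ∷ u) (map raise G) ≡ chainMasks u G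
chainMasks-raise x u []                          _ = refl
chainMasks-raise x u ((suc a , suc (suc b)) ∷ G) (v ∷ vs) =
  cong₂ (λ A B → map (false ∷_) A ++ keepIf (descent? u g) (map (true ∷_) B))
    (chainMasks-raise x u G vs) (chainMasks-raise x (swapPos u g) G (AllValid-swapPos u g G vs))
  where g = (suc a , suc (suc b))
chainMasks-raise x u ((suc a , suc zero) ∷ G) ((_ , s≤s () , _) ∷ _)

exponent : List ℕ → List (ℕ × ℕ) → ℕ
exponent w T = (inv w + inv (rmul w T) ∸ length T) / 2

half-double+ : ∀ d X → (d + d + X) / 2 ≡ d + X / 2
half-double+ zero    X = refl
half-double+ (suc d) X = begin
  (suc d + suc d + X) / 2       ≡⟨ cong (λ z → (suc z + X) / 2) (+-suc d d) ⟩
  suc (suc (d + d + X)) / 2     ≡⟨ m/n≡1+[m∸n]/n {suc (suc (d + d + X))} {2} (s≤s (s≤s z≤n)) ⟩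
  suc ((d + d + X) / 2)         ≡⟨ cong suc (half-double+ d X) ⟩
  suc d + X / 2                 ∎
  where open ≡-Reasoning

-- Two shapes of (I + J - L)/2 met below; the bound L + J ≤ I, supplied by chain-length,
-- keeps the truncated subtraction honest.
halfExcess-descent : ∀ I J L d → L + J ≤ I → ((I + suc (d + d)) + J ∸ suc L) / 2 ≡ d + (I + J ∸ L) / 2
halfExcess-descent I J L d L+J≤I = trans (cong (_/ 2) excess) (half-double+ d (I + J ∸ L))
  where
  open ≡-Reasoning
  L≤I+J : L ≤ I + J
  L≤I+J = ≤-trans (m≤m+n L J) (≤-trans L+J≤I (m≤m+n I J))
  excess : (I + suc (d + d)) + J ∸ suc L ≡ d + d + (I + J ∸ L)
  excess = begin
    (I + suc (d + d)) + J ∸ suc L ≡⟨ cong (λ z → z + J ∸ suc L) (+-suc I (d + d)) ⟩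
    I + (d + d) + J ∸ L           ≡⟨ cong (_∸ L) (arith I J d) ⟩
    d + d + (I + J) ∸ L           ≡⟨ +-∸-assoc (d + d) L≤I+J ⟩
    d + d + (I + J ∸ L)           ∎
    where arith : ∀ I J d → I + (d + d) + J ≡ d + d + (I + J)
          arith = solve-∀

halfExcess-raise : ∀ c I J L → L + J ≤ I → ((c + I) + (c + J) ∸ L) / 2 ≡ c + (I + J ∸ L) / 2
halfExcess-raise c I J L L+J≤I = begin
  ((c + I) + (c + J) ∸ L) / 2 ≡⟨ cong (λ z → (z ∸ L) / 2) (arith c I J) ⟩
  (c + c + (I + J) ∸ L) / 2   ≡⟨ cong (_/ 2) (+-∸-assoc (c + c) (≤-trans (m≤m+n L J) (≤-trans L+J≤I (m≤m+n I J)))) ⟩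
  (c + c + (I + J ∸ L)) / 2   ≡⟨ half-double+ c (I + J ∸ L) ⟩
  c + (I + J ∸ L) / 2         ∎
  where
  open ≡-Reasoning
  arith : ∀ c I J → (c + I) + (c + J) ≡ c + c + (I + J)
  arith = solve-∀

exponent-[] : ∀ w → exponent w [] ≡ inv w
exponent-[] w = trans (cong (_/ 2) (sym (ℕₚ.+-identityʳ (inv w + inv w))))
                      (trans (half-double+ (inv w) 0) (ℕₚ.+-identityʳ (inv w)))

exponent-descent : ∀ w g T d → Chain (swapPos w g) T → inv w ≡ inv (swapPos w g) + suc (d + d) →
  exponent w (g ∷ T) ≡ d + exponent (swapPos w g) T
exponent-descent w g T d c inv-drop = trans
  (cong (λ z → (z + inv (rmul (swapPos w g) T) ∸ suc (length T)) / 2) inv-drop)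
  (halfExcess-descent (inv (swapPos w g)) (inv (rmul (swapPos w g) T)) (length T) d (chain-length (swapPos w g) T c))

exponent-raise : ∀ x u T → Chain u T → AllValid (length u) T →
  exponent (x ∷ u) (map raise T) ≡ N x u + exponent u T
exponent-raise x u T c vs = begin
  (inv (x ∷ u) + inv (rmul (x ∷ u) (map raise T)) ∸ length (map raise T)) / 2
    ≡⟨ cong₂ (λ v l → (inv (x ∷ u) + inv v ∸ l) / 2) (rmul-raise x u T vs) (length-map raise T) ⟩
  (N x u + inv u + (N x (rmul u T) + inv (rmul u T)) ∸ length T) / 2
    ≡⟨ cong (λ z → (N x u + inv u + (z + inv (rmul u T)) ∸ length T) / 2) (N-↭ x (rmul-↭ u T vs)) ⟩
  (N x u + inv u + (N x u + inv (rmul u T)) ∸ length T) / 2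
    ≡⟨ halfExcess-raise (N x u) (inv u) (inv (rmul u T)) (length T) (chain-length u T c) ⟩
  N x u + exponent u T ∎
  where open ≡-Reasoning

-- column k q = ((1,k+q), (1,k+q-1), …, (1,k+1)): the first row of Γ(k) in S_{k+q}.
column : ℕ → ℕ → List (ℕ × ℕ)
column k zero    = []
column k (suc q) = (1 , suc (k + q)) ∷ column k q

applyUpTo-cong< : ∀ {A : Set} (f g : ℕ → A) m → (∀ i → i < m → f i ≡ g i) → applyUpTo f m ≡ applyUpTo g m
applyUpTo-cong< f g zero    _   = refl
applyUpTo-cong< f g (suc m) f≗g = cong₂ _∷_ (f≗g 0 (s≤s z≤n))
  (applyUpTo-cong< (f ∘ suc) (g ∘ suc) m (λ i i<m → f≗g (suc i) (s≤s i<m)))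

column-applyUpTo : ∀ k q c n → n ≡ k + q + c → applyUpTo (λ j → (1 , n ∸ (c + j))) q ≡ column k q
column-applyUpTo k zero    c n _   = refl
column-applyUpTo k (suc q) c n n≡ = cong₂ _∷_ (cong (1 ,_) first)
  (trans (applyUpTo-cong< _ _ q (λ j _ → cong (λ z → (1 , n ∸ z)) (+-suc c j)))
         (column-applyUpTo k q (suc c) n (trans n≡ (arith k q c))))
  where
  arith : ∀ k q c → k + suc q + c ≡ k + q + suc c
  arith = solve-∀
  first : n ∸ (c + 0) ≡ suc (k + q)
  first = trans (cong₂ _∸_ n≡ (ℕₚ.+-identityʳ c)) (trans (m+n∸n≡m (k + suc q) c) (+-suc k q))

concatMap-raise : ∀ (f f' : ℕ → List (ℕ × ℕ)) → (∀ a → f (suc a) ≡ map raise (f' a)) →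
  ∀ as → concat (map f (map suc as)) ≡ map raise (concat (map f' as))
concatMap-raise f f' f≗ []       = refl
concatMap-raise f f' f≗ (a ∷ as) =
  trans (cong₂ _++_ (f≗ a) (concatMap-raise f f' f≗ as)) (sym (map-++ raise (f' a) (concat (map f' as))))

Γ-decomposition : ∀ n k → k ≤ n → Γ (suc n) (suc k) ≡ column (suc k) (n ∸ k) ++ map raise (Γ n k)
Γ-decomposition n k k≤n = cong₂ _++_ firstRow laterRows
  where
  q = n ∸ k
  row : ℕ → List (ℕ × ℕ)
  row a = map (λ j → (a , suc n ∸ j)) (upTo q)
  row' : ℕ → List (ℕ × ℕ)
  row' a = map (λ j → (a , n ∸ j)) (upTo q)
  firstRow : row 1 ≡ column (suc k) q
  firstRow = trans (map-applyUpTo (λ i → i) (λ j → (1 , suc n ∸ j)) q)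
    (column-applyUpTo (suc k) q 0 (suc n) (cong suc (trans (sym (m+[n∸m]≡n k≤n)) (sym (ℕₚ.+-identityʳ (k + q))))))
  raisedRow : ∀ a → row (suc a) ≡ map raise (row' a)
  raisedRow a = trans (map-applyUpTo (λ i → i) (λ j → (suc a , suc n ∸ j)) q)
    (trans (applyUpTo-cong< _ _ q (λ j j<q → cong (suc a ,_) (+-∸-assoc 1 (≤-trans (<⇒≤ j<q) (m∸n≤m n k)))))
    (trans (sym (map-applyUpTo (λ i → i) (raise ∘ λ j → (a , n ∸ j)) q)) (map-∘ (upTo q))))
  laterRows : concat (map row (applyUpTo (suc ∘ suc) k)) ≡ map raise (Γ n k)
  laterRows = trans (cong (concat ∘ map row) (sym (map-applyUpTo suc suc k)))
                    (concatMap-raise row row' raisedRow (applyUpTo suc k))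

column-valid : ∀ k q n → 1 ≤ k → k + q ≤ n → AllValid n (column k q)
column-valid k zero    n _   _       = []
column-valid k (suc q) n 1≤k k+q<n =
  (s≤s z≤n , s≤s (≤-trans 1≤k (m≤m+n k q)) , ≤-trans (≤-reflexive (sym (+-suc k q))) k+q<n)
  ∷ column-valid k q n 1≤k (≤-trans (+-monoʳ-≤ k (n≤1+n q)) k+q<n)

Γ-valid : ∀ n k → k ≤ n → AllValid n (Γ n k)
Γ-valid n       zero    _         = []
Γ-valid (suc n) (suc k) (s≤s k≤n) rewrite Γ-decomposition n k k≤n =
  All.++⁺ (column-valid (suc k) (n ∸ k) (suc n) (s≤s z≤n) (s≤s (≤-reflexive (m+[n∸m]≡n k≤n))))
          (raise-valid (Γ n k) (Γ-valid n k k≤n))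

columnΓ-valid : ∀ k q n → k + q ≤ n → AllValid (suc n) (column (suc k) q ++ map raise (Γ n k))
columnΓ-valid k q n k+q≤n = All.++⁺ (column-valid (suc k) q (suc n) (s≤s z≤n) (s≤s k+q≤n))
  (raise-valid (Γ n k) (Γ-valid n k (≤-trans (m≤m+n k q) k+q≤n)))

drop-column : ∀ k p q (R : List (ℕ × ℕ)) → drop p (column k (p + q) ++ R) ≡ column k q ++ R
drop-column k zero    q R = refl
drop-column k (suc p) q R = drop-column k p q R

Γp-decomposition : ∀ n k q p → n ≡ k + (q + p) →
  Γp (suc n) (suc k) p ≡ column (suc k) q ++ map raise (Γ n k)
Γp-decomposition n k q p n≡ = begin
  drop p (Γ (suc n) (suc k))                           ≡⟨ cong (drop p) (Γ-decomposition n k k≤n) ⟩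
  drop p (column (suc k) (n ∸ k) ++ map raise (Γ n k)) ≡⟨ cong (λ r → drop p (column (suc k) r ++ map raise (Γ n k))) n∸k≡ ⟩
  drop p (column (suc k) (p + q) ++ map raise (Γ n k)) ≡⟨ drop-column (suc k) p q (map raise (Γ n k)) ⟩
  column (suc k) q ++ map raise (Γ n k)                ∎
  where
  open ≡-Reasoning
  k≤n : k ≤ n
  k≤n = subst (k ≤_) (sym n≡) (m≤m+n k (q + p))
  n∸k≡ : n ∸ k ≡ p + q
  n∸k≡ = trans (cong (_∸ k) n≡) (trans (m+n∸m≡n k (q + p)) (ℕₚ.+-comm q p))

split-last : ∀ (w : List ℕ) q → length w ≡ suc q →
  Σ (List ℕ) λ M → Σ ℕ λ y → (w ≡ M ++ [ y ]) × (length M ≡ q)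
split-last (a ∷ [])     zero    _  = [] , a , refl , refl
split-last (a ∷ b ∷ w)  (suc q) eq with split-last (b ∷ w) q (suc-injective eq)
... | M , y , w≡ , |M| = a ∷ M , y , cong (a ∷_) w≡ , cong suc |M|
split-last (a ∷ b ∷ w)  zero    ()
split-last (a ∷ [])     (suc q) ()

-- The inversion-count identity behind a column step: for y < x, exchanging the
-- first entry x with the entry y after v M lowers the predicted exponent by the
-- number of entries of v M strictly between y and x.
exponent-exchange : ∀ x y (v M S : List ℕ) → y < x → y ∉ v → x ∉ M →
  between y x (v ++ M) + (inv (y ∷ v) + inv (M ++ x ∷ S) + N y (x ∷ S))
    ≡ inv (x ∷ v) + inv (M ++ y ∷ S) + N x S
exponent-exchange x y v M S y<x y∉v x∉M
  rewrite between-++ y x v M | N-cons-≮ {y} S (<-asym y<x) | inv-++ M (x ∷ S) | inv-++ M (y ∷ S)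
        | crossInv-cons M x S | crossInv-cons M y S | N-between v y<x y∉v | above-between M y<x x∉M
  = arith (between y x v) (between y x M) (N y v) (inv v) (inv M) (above x M) (crossInv M S) (N x S) (inv S) (N y S)
  where arith : ∀ dv dm nyv iv iM ax c nxS iS nyS →
                dv + dm + (nyv + iv + (iM + (ax + c) + (nxS + iS)) + nyS)
                  ≡ nyv + dv + iv + (iM + (ax + dm + c) + (nyS + iS)) + nxS
        arith = solve-∀

exponent-prepend : ∀ x u w → N x (u ++ w) + (inv u + inv w) ≡ inv (x ∷ u) + inv w + N x w
exponent-prepend x u w = trans (cong (_+ (inv u + inv w)) (N-++ x u w)) (arith (N x u) (N x w) (inv u) (inv w))
  where arith : ∀ a b c d → a + b + (c + d) ≡ a + c + d + b
        arith = solve-∀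

module ChainSums {c ℓ : Level} (R : CommutativeRing c ℓ) (t : CommutativeRing.Carrier R) where
  open CommutativeRing R
    using (Carrier; _≈_; 0#; 1#; -_; +-cong; *-cong; +-assoc; +-comm; *-assoc; *-comm;
           *-identityˡ; *-identityʳ; +-identityˡ; +-identityʳ; distribˡ; zeroʳ; -‿inverseʳ; *-commutativeSemigroup)
    renaming (setoid to ≈-setoid; refl to ≈-refl; sym to ≈-sym; trans to ≈-trans; reflexive to ≈-reflexive;
              _+_ to _+R_; _*_ to _*R_; _-_ to _-R_)
  open import Relation.Binary.Reasoning.Setoid ≈-setoid
  open import Algebra.Properties.CommutativeSemigroup *-commutativeSemigroup using (interchange)

  t^_ : ℕ → Carrier
  t^ e = pow R t e

  t^-cong : ∀ {m n} → m ≡ n → t^ m ≈ t^ n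
  t^-cong e = ≈-reflexive (cong t^_ e)

  t^-+ : ∀ m n → t^ (m + n) ≈ t^ m *R t^ n
  t^-+ zero    n = ≈-sym (*-identityˡ _)
  t^-+ (suc m) n = ≈-trans (*-cong ≈-refl (t^-+ m n)) (≈-sym (*-assoc t _ _))

  chainSum : List ℕ → List (ℕ × ℕ) → Carrier
  chainSum w G = ringSum R (map (λ m → summand R t w (select m G)) (chainMasks w G))

  ringSum-++ : ∀ xs ys → ringSum R (xs ++ ys) ≈ ringSum R xs +R ringSum R ys
  ringSum-++ []       ys = ≈-sym (+-identityˡ _)
  ringSum-++ (x ∷ xs) ys = ≈-trans (+-cong ≈-refl (ringSum-++ xs ys)) (≈-sym (+-assoc x _ _))

  ringSum-↭ : ∀ {xs ys} → xs ↭ ys → ringSum R xs ≈ ringSum R ys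
  ringSum-↭ ↭.refl         = ≈-refl
  ringSum-↭ (↭.prep x p)   = +-cong ≈-refl (ringSum-↭ p)
  ringSum-↭ (↭.swap x y p) =
    ≈-trans (≈-sym (+-assoc x y _)) (≈-trans (+-cong (+-comm x y) (ringSum-↭ p)) (+-assoc y x _))
  ringSum-↭ (↭.trans p q)  = ≈-trans (ringSum-↭ p) (ringSum-↭ q)

  ringSum-cong : ∀ {A : Set} (f g : A → Carrier) L → (∀ m → m ∈ L → f m ≈ g m) →
    ringSum R (map f L) ≈ ringSum R (map g L)
  ringSum-cong f g []      _   = ≈-refl
  ringSum-cong f g (m ∷ L) f≈g = +-cong (f≈g m (here refl)) (ringSum-cong f g L (λ z p → f≈g z (there p)))

  ringSum-scale : ∀ {A : Set} a (f : A → Carrier) L → ringSum R (map (λ m → a *R f m) L) ≈ a *R ringSum R (map f L)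
  ringSum-scale a f []      = ≈-sym (zeroʳ a)
  ringSum-scale a f (m ∷ L) = ≈-trans (+-cong ≈-refl (ringSum-scale a f L)) (≈-sym (distribˡ a _ _))

  t+[1-t] : t +R (1# -R t) ≈ 1#
  t+[1-t] = begin
    t +R (1# +R - t) ≈⟨ +-cong ≈-refl (+-comm 1# (- t)) ⟩
    t +R (- t +R 1#) ≈⟨ +-assoc t (- t) 1# ⟨
    t +R - t +R 1#   ≈⟨ +-cong (-‿inverseʳ t) ≈-refl ⟩
    0# +R 1#         ≈⟨ +-identityˡ 1# ⟩
    1#               ∎

  t^-collapse : ∀ A d B → d + B ≡ A → t^ (suc A) +R (t^ d *R (1# -R t)) *R t^ B ≈ t^ A
  t^-collapse A d B d+B≡A = begin
    t *R t^ A +R (t^ d *R (1# -R t)) *R t^ B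
      ≈⟨ +-cong (*-comm t _) (≈-trans (*-assoc _ _ _) (≈-trans (*-cong ≈-refl (*-comm _ _)) (≈-sym (*-assoc _ _ _)))) ⟩
    t^ A *R t +R (t^ d *R t^ B) *R (1# -R t)
      ≈⟨ +-cong ≈-refl (*-cong (≈-trans (≈-sym (t^-+ d B)) (t^-cong d+B≡A)) ≈-refl) ⟩
    t^ A *R t +R t^ A *R (1# -R t) ≈⟨ distribˡ (t^ A) t _ ⟨
    t^ A *R (t +R (1# -R t))       ≈⟨ *-cong ≈-refl t+[1-t] ⟩
    t^ A *R 1#                     ≈⟨ *-identityʳ _ ⟩
    t^ A                           ∎

  summand-descent : ∀ w g T d → Chain (swapPos w g) T → inv w ≡ inv (swapPos w g) + suc (d + d) →
    summand R t w (g ∷ T) ≈ (t^ d *R (1# -R t)) *R summand R t (swapPos w g) T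
  summand-descent w g T d c inv-drop = begin
    t^ exponent w (g ∷ T) *R ((1# -R t) *R pow R (1# -R t) (length T))
      ≈⟨ *-cong (t^-cong (exponent-descent w g T d c inv-drop)) ≈-refl ⟩
    t^ (d + exponent (swapPos w g) T) *R ((1# -R t) *R pow R (1# -R t) (length T))
      ≈⟨ *-cong (t^-+ d _) ≈-refl ⟩
    (t^ d *R t^ exponent (swapPos w g) T) *R ((1# -R t) *R pow R (1# -R t) (length T))
      ≈⟨ interchange _ _ _ _ ⟩
    (t^ d *R (1# -R t)) *R summand R t (swapPos w g) T ∎

  summand-raise : ∀ x u T → Chain u T → AllValid (length u) T →
    summand R t (x ∷ u) (map raise T) ≈ t^ N x u *R summand R t u T
  summand-raise x u T c vs = begin
    t^ exponent (x ∷ u) (map raise T) *R pow R (1# -R t) (length (map raise T))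
      ≈⟨ *-cong (t^-cong (exponent-raise x u T c vs)) (≈-reflexive (cong (pow R (1# -R t)) (length-map raise T))) ⟩
    t^ (N x u + exponent u T) *R pow R (1# -R t) (length T)
      ≈⟨ ≈-trans (*-cong (t^-+ (N x u) _) ≈-refl) (*-assoc _ _ _) ⟩
    t^ N x u *R summand R t u T ∎

  chainSum-[] : ∀ w → chainSum w [] ≈ t^ inv w
  chainSum-[] w = ≈-trans (+-identityʳ _) (≈-trans (*-identityʳ _) (t^-cong (exponent-[] w)))

  chainSum-ascent : ∀ w g G → ¬ Descent w g → chainSum w (g ∷ G) ≈ chainSum w G
  chainSum-ascent w g G ¬d with descent? w g
  ... | yes d = ⊥-elim (¬d d)
  ... | no _  = ≈-reflexive (trans (cong (ringSum R ∘ map F) (++-identityʳ (map (false ∷_) (chainMasks w G))))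
                                   (cong (ringSum R) (sym (map-∘ (chainMasks w G)))))
    where F = λ m → summand R t w (select m (g ∷ G))

  chainSum-descent : ∀ w g G d → Valid (length w) g → AllValid (length w) G → Unique w → Descent w g →
    inv w ≡ inv (swapPos w g) + suc (d + d) →
    chainSum w (g ∷ G) ≈ chainSum w G +R (t^ d *R (1# -R t)) *R chainSum (swapPos w g) G
  chainSum-descent w g G d v vs u desc inv-drop with descent? w g
  ... | no ¬d = ⊥-elim (¬d desc)
  ... | yes _ = begin
    ringSum R (map F (map (false ∷_) V ++ map (true ∷_) V'))
      ≈⟨ ≈-reflexive (cong (ringSum R) (map-++ F (map (false ∷_) V) (map (true ∷_) V'))) ⟩
    ringSum R (map F (map (false ∷_) V) ++ map F (map (true ∷_) V'))
      ≈⟨ ringSum-++ (map F (map (false ∷_) V)) _ ⟩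
    ringSum R (map F (map (false ∷_) V)) +R ringSum R (map F (map (true ∷_) V'))
      ≈⟨ +-cong (≈-reflexive (cong (ringSum R) (sym (map-∘ V)))) (≈-reflexive (cong (ringSum R) (sym (map-∘ V')))) ⟩
    chainSum w G +R ringSum R (map (λ m → summand R t w (g ∷ select m G)) V')
      ≈⟨ +-cong ≈-refl (ringSum-cong _ _ V' λ m p → summand-descent w g (select m G) d
           (proj₂ (chainMasks-sound (swapPos w g) G (AllValid-swapPos w g G vs) (swapPos-unique w g v u) m p)) inv-drop) ⟩
    chainSum w G +R ringSum R (map (λ m → (t^ d *R (1# -R t)) *R summand R t (swapPos w g) (select m G)) V')
      ≈⟨ +-cong ≈-refl (ringSum-scale _ _ V') ⟩
    chainSum w G +R (t^ d *R (1# -R t)) *R chainSum (swapPos w g) G ∎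
    where
    F = λ m → summand R t w (select m (g ∷ G))
    V = chainMasks w G
    V' = chainMasks (swapPos w g) G

  chainSum-raise : ∀ x u G → AllValid (length u) G → Unique u →
    chainSum (x ∷ u) (map raise G) ≈ t^ N x u *R chainSum u G
  chainSum-raise x u G vs uu = begin
    ringSum R (map (λ m → summand R t (x ∷ u) (select m (map raise G))) (chainMasks (x ∷ u) (map raise G)))
      ≡⟨ cong (λ V → ringSum R (map (λ m → summand R t (x ∷ u) (select m (map raise G))) V)) (chainMasks-raise x u G vs) ⟩
    ringSum R (map (λ m → summand R t (x ∷ u) (select m (map raise G))) (chainMasks u G))
      ≈⟨ ringSum-cong _ _ (chainMasks u G) (λ m p →
           ≈-trans (≈-reflexive (cong (summand R t (x ∷ u)) (select-raise m G)))
                   (summand-raise x u (select m G) (proj₂ (chainMasks-sound u G vs uu m p)) (select-valid m G vs))) ⟩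
    ringSum R (map (λ m → t^ N x u *R summand R t u (select m G)) (chainMasks u G))
      ≈⟨ ringSum-scale _ _ (chainMasks u G) ⟩
    t^ N x u *R chainSum u G ∎

  masks-sum : ∀ w G → AllValid (length w) G → Unique w →
    (masks : List (List Bool)) → Unique masks →
    (∀ m → (m ∈ masks) ⇔ ((length m ≡ length G) × Chain w (select m G))) →
    ringSum R (map (λ m → summand R t w (select m G)) masks) ≈ chainSum w G
  masks-sum w G vs u masks um iff = ringSum-↭ (↭.map⁺ _ (chainMasks-↭ w G vs u masks um iff))

  -- One step down the column: the transposition (1, |Mm|+2) exchanges the first
  -- entry x of  x Mm y S  with y.
  column-step : ∀ {u j} x Mm y S G A B → u ≡ x ∷ Mm ++ y ∷ S → length Mm ≡ j →
    AllValid (length u) G → Unique u →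
    chainSum u G ≈ t^ (A + N x (y ∷ S)) →
    chainSum (y ∷ Mm ++ x ∷ S) G ≈ t^ B →
    (y < x → y ∉ Mm → x ∉ Mm → between y x Mm + B ≡ A + N x S) →
    chainSum u ((1 , suc (suc j)) ∷ G) ≈ t^ (A + N x S)
  column-step x Mm y S G A B refl refl vs uniq sum₁ sum₂ exchange with y <? x
  ... | no y≮x = begin
    chainSum u (g ∷ G)    ≈⟨ chainSum-ascent u g G (y≮x ∘ subst (_< x) y-at-b) ⟩
    chainSum u G          ≈⟨ sum₁ ⟩
    t^ (A + N x (y ∷ S))  ≡⟨ cong (λ z → t^ (A + z)) (N-cons-≮ S y≮x) ⟩
    t^ (A + N x S)        ∎
    where
    u = x ∷ Mm ++ y ∷ S
    g = (1 , suc (suc (length Mm)))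
    y-at-b : entry u (suc (suc (length Mm))) ≡ y
    y-at-b = entry-second [] x Mm y S
  ... | yes y<x = begin
    chainSum u (g ∷ G)
      ≈⟨ chainSum-descent u g G d g-valid vs uniq (subst (_< x) (sym (entry-second [] x Mm y S)) y<x) inv-drop ⟩
    chainSum u G +R (t^ d *R (1# -R t)) *R chainSum (swapPos u g) G
      ≈⟨ +-cong sum₁ (*-cong ≈-refl (≈-trans (≈-reflexive (cong (λ w → chainSum w G) swapped)) sum₂)) ⟩
    t^ (A + N x (y ∷ S)) +R (t^ d *R (1# -R t)) *R t^ B
      ≡⟨ cong (λ z → t^ z +R (t^ d *R (1# -R t)) *R t^ B) (trans (cong (A +_) (N-cons-< S y<x)) (+-suc A (N x S))) ⟩
    t^ suc (A + N x S) +R (t^ d *R (1# -R t)) *R t^ B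
      ≈⟨ t^-collapse (A + N x S) d B (exchange y<x y∉M x∉M) ⟩
    t^ (A + N x S) ∎
    where
    u = x ∷ Mm ++ y ∷ S
    g = (1 , suc (suc (length Mm)))
    open Distinct (distinct [] x Mm y S uniq)
    d = between y x Mm
    swapped : swapPos u g ≡ y ∷ Mm ++ x ∷ S
    swapped = swapPos-exchange [] x Mm y S
    inv-drop : inv u ≡ inv (swapPos u g) + suc (d + d)
    inv-drop = trans (inv-exchange [] Mm S y<x x∉M y∉M) (cong (λ w → inv w + suc (d + d)) (sym swapped))
    g-valid : Valid (length u) g
    g-valid = s≤s z≤n , s≤s (s≤s z≤n) ,
              s≤s (subst (suc (length Mm) ≤_) (sym (length-++ Mm)) (m<m+n (length Mm) (s≤s z≤n)))

  -- Case w₂ = [] with k ≥ 1: the column is empty, and Γ(k) on x x' v w₃ is the raise of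
  -- the Γ(k-1)-sequence acting on the tail x' v w₃, whose sum is known by induction.
  raised-step : ∀ x x' v w₃ → Unique (x' ∷ v ++ w₃) →
    chainSum (x' ∷ v ++ w₃) (column (suc (length v)) (length w₃) ++ map raise (Γ (length (v ++ w₃)) (length v)))
      ≈ t^ (inv (x' ∷ v) + inv w₃) →
    chainSum (x ∷ x' ∷ v ++ w₃) (map raise (Γ (suc (length (v ++ w₃))) (suc (length v))))
      ≈ t^ (inv (x ∷ x' ∷ v) + inv w₃ + N x w₃)
  raised-step x x' v w₃ uniq tailSum = begin
    chainSum (x ∷ u) (map raise (Γ (suc L) (suc k)))
      ≈⟨ chainSum-raise x u _ (Γ-valid (suc L) (suc k) (s≤s k≤L)) uniq ⟩
    t^ N x u *R chainSum u (Γ (suc L) (suc k))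
      ≡⟨ cong (λ G → t^ N x u *R chainSum u G) (Γp-decomposition L k (length w₃) 0 L≡) ⟩
    t^ N x u *R chainSum u (column (suc k) (length w₃) ++ map raise (Γ L k))
      ≈⟨ *-cong ≈-refl tailSum ⟩
    t^ N x u *R t^ (inv (x' ∷ v) + inv w₃)
      ≈⟨ t^-+ (N x u) _ ⟨
    t^ (N x u + (inv (x' ∷ v) + inv w₃))
      ≡⟨ cong t^_ (exponent-prepend x (x' ∷ v) w₃) ⟩
    t^ (inv (x ∷ x' ∷ v) + inv w₃ + N x w₃) ∎
    where
    u = x' ∷ v ++ w₃
    k = length v
    L = length (v ++ w₃)
    L≡ : L ≡ k + (length w₃ + 0)
    L≡ = trans (length-++ v) (cong (k +_) (sym (ℕₚ.+-identityʳ (length w₃))))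
    k≤L : k ≤ L
    k≤L = subst (k ≤_) (sym (length-++ v)) (m≤m+n k (length w₃))

  mainSum : ∀ k n q x v w₂ w₃ u → u ≡ x ∷ v ++ w₂ ++ w₃ → length v ≡ k → length w₂ ≡ q →
    length u ≡ suc n → Unique u →
    chainSum u (column (suc k) q ++ map raise (Γ n k)) ≈ t^ (inv (x ∷ v) + inv (w₂ ++ w₃) + N x w₃)
  mainSum zero n zero x [] [] w₃ _ refl refl refl _ _ =
    ≈-trans (chainSum-[] (x ∷ w₃)) (t^-cong (ℕₚ.+-comm (N x w₃) (inv w₃)))
  -- q = 0, k ≥ 1: induction on k, for the tail x' v w₃ read as x' v w₃ [].
  mainSum (suc k) n zero x (x' ∷ v) [] w₃ _ refl refl refl refl (_ ∷ uniq₀) =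
    raised-step x x' v w₃ uniq₀ (≈-trans
      (mainSum k (length (v ++ w₃)) (length w₃) x' v w₃ [] (x' ∷ v ++ w₃)
               (cong (λ z → x' ∷ v ++ z) (sym (++-identityʳ w₃))) refl refl refl uniq₀)
      (t^-cong (trans (ℕₚ.+-identityʳ _) (cong (λ z → inv (x' ∷ v) + inv z) (++-identityʳ w₃)))))
  -- q ≥ 1: write w₂ = M y; induction on q for  x v M (y w₃)  and  y v M (x w₃).
  mainSum k n (suc q) x v w₂ w₃ u u≡ |v| |w₂| len uniq with split-last w₂ q |w₂|
  ... | M , y , refl , |M| = ≈-trans
    (column-step x Mm y w₃ G A B u≡Mm |Mm| valid uniq
       (mainSum k n q x v M (y ∷ w₃) u (trans u≡Mm (cong (x ∷_) (++-assoc v M (y ∷ w₃)))) |v| |M| len uniq)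
       (mainSum k n q y v M (x ∷ w₃) (y ∷ Mm ++ x ∷ w₃) (cong (y ∷_) (++-assoc v M (x ∷ w₃))) |v| |M|
          (trans (sym (↭.↭-length exchanged)) len≡) (unique-↭ exchanged (subst Unique u≡Mm uniq)))
       (λ y<x y∉ x∉ → exponent-exchange x y v M w₃ y<x (y∉ ∘ ∈-++⁺ˡ) (x∉ ∘ ∈-++⁺ʳ v)))
    (t^-cong (cong (λ z → inv (x ∷ v) + inv z + N x w₃) (sym (++-assoc M [ y ] w₃))))
    where
    Mm = v ++ M
    G = column (suc k) q ++ map raise (Γ n k)
    A = inv (x ∷ v) + inv (M ++ y ∷ w₃)
    B = inv (y ∷ v) + inv (M ++ x ∷ w₃) + N y (x ∷ w₃)
    u≡Mm : u ≡ x ∷ Mm ++ y ∷ w₃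
    u≡Mm = trans u≡ (cong (x ∷_) (trans (cong (v ++_) (++-assoc M [ y ] w₃)) (sym (++-assoc v M (y ∷ w₃)))))
    |Mm| : length Mm ≡ k + q
    |Mm| = trans (length-++ v) (cong₂ _+_ |v| |M|)
    exchanged : x ∷ Mm ++ y ∷ w₃ ↭ y ∷ Mm ++ x ∷ w₃
    exchanged = exchange-↭ [] x Mm y w₃
    len≡ : length (x ∷ Mm ++ y ∷ w₃) ≡ suc n
    len≡ = trans (cong length (sym u≡Mm)) len
    n≡ : length Mm + suc (length w₃) ≡ n
    n≡ = suc-injective (trans (cong suc (sym (length-++ Mm))) len≡)
    valid : AllValid (length u) G
    valid = subst (λ m → AllValid m G) (sym len)
      (columnΓ-valid k q n (subst₂ _≤_ |Mm| n≡ (m≤m+n (length Mm) (suc (length w₃)))))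
  mainSum zero    _ zero _ (_ ∷ _) _       _ _ _ () _ _ _
  mainSum (suc _) _ zero _ []      _       _ _ _ () _ _ _
  mainSum _       _ zero _ _       (_ ∷ _) _ _ _ _ () _ _

idPerm-unique : ∀ n → Unique (idPerm n)
idPerm-unique n = Unique.applyUpTo⁺₁ suc n (λ i<j _ e → ℕₚ.<⇒≢ i<j (suc-injective e))

proposition5p2 : {c ℓ : Level} (R : CommutativeRing c ℓ) (t : CommutativeRing.Carrier R)
    (n k p : ℕ) → 1 ≤ k → k + p ≤ n →
    (w : List ℕ) → w ↭ idPerm n →
    (w₁ w₂ w₃ : List ℕ) → length w₁ ≡ k → length w₃ ≡ p → w ≡ w₁ ++ w₂ ++ w₃ →
    (masks : List (List Bool)) → Unique masks →
    (∀ m → (m ∈ masks) ⇔ InA n k p w m) →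
    CommutativeRing._≈_ R
      (ringSum R (map (λ m → summand R t w (select m (Γp n k p))) masks))
      (pow R t (inv w₁ + inv (w₂ ++ w₃) + N (entry w 1) w₃))
-- With w = x v w₂ w₃: pass from the given masks to chainMasks, identify Γ(k,p) as
-- column k |w₂| ++ raised Γ(k-1), and apply the main induction.
proposition5p2 R t n _ _ () _ _ _ [] _ _ refl _ _ _ _ _
proposition5p2 R t n _ _ _ k+p≤n u u↭id (x ∷ v) w₂ w₃ refl refl refl masks um iff = begin
  ringSum R (map (λ m → summand R t u (select m (Γp n K P))) masks)
    ≈⟨ masks-sum u (Γp n K P) valid uniq masks um iff ⟩
  chainSum u (Γp n K P)
    ≡⟨ cong (λ m → chainSum u (Γp m K P)) (sym |u|) ⟩
  chainSum u (Γp (suc L) K P)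
    ≡⟨ cong (chainSum u) (Γp-decomposition L (length v) (length w₂) P (trans (length-++ v) (cong (length v +_) (length-++ w₂)))) ⟩
  chainSum u (column K (length w₂) ++ map raise (Γ L (length v)))
    ≈⟨ mainSum (length v) L (length w₂) x v w₂ w₃ u refl refl refl refl uniq ⟩
  t^ (inv (x ∷ v) + inv (w₂ ++ w₃) + N x w₃) ∎
  where
  open ChainSums R t
  open import Relation.Binary.Reasoning.Setoid (CommutativeRing.setoid R)
  K = suc (length v)
  P = length w₃
  L = length (v ++ w₂ ++ w₃)
  |u| : length u ≡ n
  |u| = trans (↭.↭-length u↭id) (length-applyUpTo suc n)
  uniq : Unique u
  uniq = unique-↭ (↭-sym u↭id) (idPerm-unique n)
  valid : AllValid (length u) (Γp n K P)
  valid = subst (λ m → AllValid m (Γp n K P)) (sym |u|)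
                (All.drop⁺ P (Γ-valid n K (≤-trans (m≤m+n K P) k+p≤n)))
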